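{- In three-pile Sharing Nim, let $a<b$ be positive integers such that $a \oplus b \oplus (a+b) = 0$. Then the position with pile sizes $(a,b,a+b)$ is an N-position.
   Context: Sharing Nim: a position is a triple of nonnegative integers (pile sizes). Two players alternate moves. A move is either (a) removing a positive number of objects from one pile, or (b) transferring a positive number of objects from one pile to another pile, subject to the restriction that objects may not be transferred from a pile of greater size to a pile of smaller size. The player who removes the last object wins (a player with no legal move loses). $\oplus$ denotes bitwise exclusive-or. An N-position is a position from which the player about to move has a winning strategy. -}

module Defs where

open import Data.Nat using (ℕ; zero; suc; _+_; _*_; _≤_; _<_)
open import Data.Nat.DivMod using (_/_; _%_)
open import Data.Fin using (Fin)
open import Data.Product using (Σ; _×_; _,_)
open import Relation.Binary.PropositionalEquality using (_≡_; _≢_)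
open import Relation.Nullary using (¬_)

-- Bitwise exclusive-or on ℕ, computed bit by bit.  The fuel argument
-- (initialised to m + n) exceeds the number of bits needed.
xorFuel : ℕ → ℕ → ℕ → ℕ
xorFuel zero    m n = 0
xorFuel (suc k) m n = ((m % 2 + n % 2) % 2) + 2 * xorFuel k (m / 2) (n / 2)

infixl 6 _⊕_
_⊕_ : ℕ → ℕ → ℕ
m ⊕ n = xorFuel (m + n) m n

Position : Set
Position = Fin 3 → ℕ

data Move (p q : Position) : Set where
  remove   : (i : Fin 3) (k : ℕ) → 0 < k →
             p i ≡ q i + k →
             (∀ l → l ≢ i → q l ≡ p l) →
             Move p q
  transfer : (i j : Fin 3) (k : ℕ) → i ≢ j → 0 < k → p i ≤ p j →
             p i ≡ q i + k →
             q j ≡ p j + k →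
             (∀ l → l ≢ i → l ≢ j → q l ≡ p l) →
             Move p q

-- N-positions (player to move has a winning strategy) and
-- P-positions (every move leads to an N-position), defined inductively,
-- so a winning strategy wins in finitely many moves.
data IsN (p : Position) : Set
data IsP (p : Position) : Set

data IsN p where
  win : (q : Position) → Move p q → IsP q → IsN p

data IsP p where
  lose : ((q : Position) → Move p q → IsN q) → IsP p

pos : ℕ → ℕ → ℕ → Position
pos a b c Fin.zero = a
pos a b c (Fin.suc Fin.zero) = b
pos a b c (Fin.suc (Fin.suc Fin.zero)) = c

-- Moving all of the smallest pile onto
-- the middle one (allowed since a < b) leaves (0, a + b, a + b), and every
-- position (0, c, c) is a P-position by a mirror strategy: objects can never
-- be transferred onto the empty pile, so any move leaves a position (0, d, e)
-- or (0, e, d) with d < c and d < e, and removing e − d objects restores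
-- (0, d, d).
module Submission where

open import Defs
open import Data.Nat using (ℕ; _+_; _∸_; _<_; _≤_)
open import Data.Nat.Properties
  using (+-comm; <⇒≤; <-≤-trans; m<m+n; m≤m+n; n≮0; m<n⇒0<n∸m; m+[n∸m]≡n)
open import Data.Nat.Induction using (<-rec)
open import Data.Fin using (Fin; zero; suc)
open import Data.Product using (∃-syntax; _×_; _,_)
open import Data.Empty using (⊥-elim)
open import Relation.Binary.PropositionalEquality using (_≡_; _≢_; refl; sym; trans; subst)

twin : ℕ → Position
twin c = pos 0 c c

data Lopsided (d : ℕ) (q : Position) : Set where
  left  : ∀ {e} → q zero ≡ 0 → q (suc zero) ≡ d → q (suc (suc zero)) ≡ e → d < e →
          Lopsided d q
  right : ∀ {e} → q zero ≡ 0 → q (suc zero) ≡ e → q (suc (suc zero)) ≡ d → d < e →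
          Lopsided d q

m≡n+k⇒n<m : ∀ {m n k} → 0 < k → m ≡ n + k → n < m
m≡n+k⇒n<m {n = n} k>0 m≡n+k = subst (n <_) (sym m≡n+k) (m<m+n n k>0)

m≡n+k⇒n≤m : ∀ {m n k} → m ≡ n + k → n ≤ m
m≡n+k⇒n≤m {n = n} {k} m≡n+k = subst (n ≤_) (sym m≡n+k) (m≤m+n n k)

lopsided⇒move-to-twin : ∀ {d q} → Lopsided d q → Move q (twin d)
lopsided⇒move-to-twin {d} {q} (left {e} q₀ q₁ q₂ d<e) =
  remove (suc (suc zero)) (e ∸ d) (m<n⇒0<n∸m d<e)
         (trans q₂ (sym (m+[n∸m]≡n (<⇒≤ d<e)))) unchanged
  where
  unchanged : ∀ l → l ≢ suc (suc zero) → twin d l ≡ q l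
  unchanged zero                _   = sym q₀
  unchanged (suc zero)          _   = sym q₁
  unchanged (suc (suc zero))    l≢2 = ⊥-elim (l≢2 refl)
lopsided⇒move-to-twin {d} {q} (right {e} q₀ q₁ q₂ d<e) =
  remove (suc zero) (e ∸ d) (m<n⇒0<n∸m d<e)
         (trans q₁ (sym (m+[n∸m]≡n (<⇒≤ d<e)))) unchanged
  where
  unchanged : ∀ l → l ≢ suc zero → twin d l ≡ q l
  unchanged zero                _   = sym q₀
  unchanged (suc zero)          l≢1 = ⊥-elim (l≢1 refl)
  unchanged (suc (suc zero))    _   = sym q₂

twin-move⇒lopsided : ∀ {c q} → Move (twin c) q → ∃[ d ] d < c × Lopsided d q
twin-move⇒lopsided (remove zero k k>0 c≡q+k _) = ⊥-elim (n≮0 (m≡n+k⇒n<m k>0 c≡q+k))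
twin-move⇒lopsided {q = q} (remove (suc zero) k k>0 c≡q+k same) =
  q (suc zero) , m≡n+k⇒n<m k>0 c≡q+k ,
  left (same zero (λ ())) refl (same (suc (suc zero)) (λ ())) (m≡n+k⇒n<m k>0 c≡q+k)
twin-move⇒lopsided {q = q} (remove (suc (suc zero)) k k>0 c≡q+k same) =
  q (suc (suc zero)) , m≡n+k⇒n<m k>0 c≡q+k ,
  right (same zero (λ ())) (same (suc zero) (λ ())) refl (m≡n+k⇒n<m k>0 c≡q+k)
twin-move⇒lopsided (transfer zero _ k _ k>0 _ 0≡q+k _ _) = ⊥-elim (n≮0 (m≡n+k⇒n<m k>0 0≡q+k))
twin-move⇒lopsided (transfer (suc zero) zero k _ k>0 c≤0 c≡q+k _ _) =
  ⊥-elim (n≮0 (<-≤-trans (m≡n+k⇒n<m k>0 c≡q+k) c≤0))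
twin-move⇒lopsided (transfer (suc (suc zero)) zero k _ k>0 c≤0 c≡q+k _ _) =
  ⊥-elim (n≮0 (<-≤-trans (m≡n+k⇒n<m k>0 c≡q+k) c≤0))
twin-move⇒lopsided (transfer (suc zero) (suc zero) _ i≢i _ _ _ _ _) = ⊥-elim (i≢i refl)
twin-move⇒lopsided (transfer (suc (suc zero)) (suc (suc zero)) _ i≢i _ _ _ _ _) =
  ⊥-elim (i≢i refl)
twin-move⇒lopsided {q = q} (transfer (suc zero) (suc (suc zero)) k _ k>0 _ c≡q+k q≡c+k same) =
  q (suc zero) , m≡n+k⇒n<m k>0 c≡q+k ,
  left (same zero (λ ()) (λ ())) refl refl (<-≤-trans (m≡n+k⇒n<m k>0 c≡q+k) (m≡n+k⇒n≤m q≡c+k))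
twin-move⇒lopsided {q = q} (transfer (suc (suc zero)) (suc zero) k _ k>0 _ c≡q+k q≡c+k same) =
  q (suc (suc zero)) , m≡n+k⇒n<m k>0 c≡q+k ,
  right (same zero (λ ()) (λ ())) refl refl (<-≤-trans (m≡n+k⇒n<m k>0 c≡q+k) (m≡n+k⇒n≤m q≡c+k))

twin-isP : ∀ c → IsP (twin c)
twin-isP = <-rec (λ c → IsP (twin c)) step
  where
  step : ∀ c → (∀ {d} → d < c → IsP (twin d)) → IsP (twin c)
  step c smaller = lose λ q m → let d , d<c , lop = twin-move⇒lopsided m in
    win (twin d) (lopsided⇒move-to-twin lop) (smaller d<c)

lemma6p4 : (a b : ℕ) → 0 < a → a < b → a ⊕ b ⊕ (a + b) ≡ 0 →
    IsN (pos a b (a + b))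
lemma6p4 a b a>0 a<b _ =
  win (twin (a + b)) (transfer zero (suc zero) a (λ ()) a>0 (<⇒≤ a<b) refl (+-comm a b) unchanged)
      (twin-isP (a + b))
  where
  unchanged : ∀ l → l ≢ zero → l ≢ suc zero → twin (a + b) l ≡ pos a b (a + b) l
  unchanged zero             l≢0 _   = ⊥-elim (l≢0 refl)
  unchanged (suc zero)       _   l≢1 = ⊥-elim (l≢1 refl)
  unchanged (suc (suc zero)) _   _   = refl
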